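{- For integers $r\ge 1$ and $m\ge 1$, let \[J_{r,m}=\{(j_1,\dots,j_r)\in\mathbb{Z}^r:\ 1\le j_1<\dots<j_r\le m,\ j_k\le j_{k+1}-2\ \text{for all } k=1,\dots,r-1\}.\] Then \[\sum_{(j_1,\dots,j_r)\in J_{r,m}}\ \prod_{k=1}^{r} j_{k}=\frac{(m+1)_{2r}}{2^r\, r!},\] where $(x)_t=x(x-1)\cdots(x-t+1)$ denotes the falling factorial. -}

module Defs where

open import Data.Nat using (ℕ; zero; suc; _+_; _*_; _∸_; _^_; _≤_; _≤?_)
open import Data.List using (List; []; _∷_; map; concatMap; filter; upTo)
open import Data.Nat.ListAction using (sum)
open import Data.Vec using (Vec; []; _∷_)
open import Data.Unit using (⊤)
open import Data.Product using (_×_; _,_)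
open import Relation.Nullary using (Dec; yes; no)
open import Relation.Nullary.Decidable using (_×-dec_)
open import Relation.Unary using (Decidable)

prodVec : ∀ {r} → Vec ℕ r → ℕ
prodVec []       = 1
prodVec (x ∷ xs) = x * prodVec xs

allVecs : (r m : ℕ) → List (Vec ℕ r)
allVecs zero    m = [] ∷ []
allVecs (suc r) m = concatMap (λ x → map (x ∷_) (allVecs r m)) (upTo (suc m))

-- Gap condition: consecutive entries satisfy j_k + 2 ≤ j_{k+1}
-- (this is j_k ≤ j_{k+1} - 2, which also gives j_k < j_{k+1}).
Gaps : ∀ {r} → Vec ℕ r → Set
Gaps []           = ⊤
Gaps (x ∷ [])     = ⊤
Gaps (x ∷ y ∷ ys) = (x + 2 ≤ y) × Gaps (y ∷ ys)

Bounded : ∀ {r} → ℕ → Vec ℕ r → Set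
Bounded m []       = ⊤
Bounded m (x ∷ xs) = (1 ≤ x × x ≤ m) × Bounded m xs

InJ : ∀ {r} → ℕ → Vec ℕ r → Set
InJ m v = Bounded m v × Gaps v

gaps? : ∀ {r} (v : Vec ℕ r) → Dec (Gaps v)
gaps? []           = yes _
gaps? (x ∷ [])     = yes _
gaps? (x ∷ y ∷ ys) = (x + 2 ≤? y) ×-dec gaps? (y ∷ ys)

bounded? : ∀ {r} (m : ℕ) (v : Vec ℕ r) → Dec (Bounded m v)
bounded? m []       = yes _
bounded? m (x ∷ xs) = ((1 ≤? x) ×-dec (x ≤? m)) ×-dec bounded? m xs

inJ? : ∀ {r} (m : ℕ) → Decidable (InJ {r} m)
inJ? m v = bounded? m v ×-dec gaps? v

J : (r m : ℕ) → List (Vec ℕ r)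
J r m = filter (inJ? m) (allVecs r m)

sumJ : (r m : ℕ) → ℕ
sumJ r m = sum (map prodVec (J r m))

-- Split J_{r,m} according to whether m is an entry: tuples avoiding m form J_{r,m-1}, and
-- tuples ending in m are (j₁,…,j_{r-1}) ∈ J_{r-1,m-2} extended by m.  Hence the sum S(r, m)
-- of the products satisfies S(r, m) = S(r, m-1) + m · S(r-1, m-2),
-- which, multiplied by 2^r r!, is the Pascal rule (m+1)_{2r} = (m)_{2r} + 2r (m)_{2r-1} for
-- falling factorials.  Since J is enumerated by its smallest entry, the recurrence is proved
-- by induction on r for gapped tuples with an arbitrary lower bound on the smallest entry.
module Submission where

open import Defs
open import Data.Nat using (ℕ; _+_; _*_; _^_; _≤_; _!)
open import Data.Nat.Combinatorics using (_P_)
open import Relation.Binary.PropositionalEquality using (_≡_)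

open import Data.Nat using (zero; suc; _∸_; _<_; z≤n; s≤s; _≤?_)
open import Data.Nat.Properties
open import Data.Nat.DivMod using (_/_; m*n/n≡m)
open import Data.Nat.Combinatorics using (nPk≡n!/[n∸k]!; k>n⇒nPk≡0)
open import Data.Nat.ListAction using (sum)
open import Data.Nat.ListAction.Properties using (sum-++)
open import Data.Nat.Tactic.RingSolver using (solve-∀)
open import Data.List using (List; []; _∷_; _++_; map; concatMap; filter; upTo)
open import Data.List.Properties using (map-++; map-∘; map-cong; upTo-∷ʳ)
open import Data.Vec using (Vec; []; _∷_)
open import Data.Unit using (⊤; tt)
open import Data.Empty using (⊥-elim)
open import Data.Product using (_×_; _,_; proj₁)
open import Function using (_∘_)
open import Relation.Nullary using (¬_; yes; no)
open import Relation.Unary using (Decidable)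
open import Relation.Binary.PropositionalEquality
  using (refl; sym; trans; cong; cong₂; subst; module ≡-Reasoning)

open ≡-Reasoning

𝟙[_≤_] : ℕ → ℕ → ℕ
𝟙[ zero  ≤ x     ] = 1
𝟙[ suc l ≤ zero  ] = 0
𝟙[ suc l ≤ suc x ] = 𝟙[ l ≤ x ]

≤⇒𝟙≡1 : ∀ {l x} → l ≤ x → 𝟙[ l ≤ x ] ≡ 1
≤⇒𝟙≡1 z≤n       = refl
≤⇒𝟙≡1 (s≤s l≤x) = ≤⇒𝟙≡1 l≤x

>⇒𝟙≡0 : ∀ {l x} → x < l → 𝟙[ l ≤ x ] ≡ 0
>⇒𝟙≡0 {x = zero}  (s≤s _)   = refl
>⇒𝟙≡0 {x = suc x} (s≤s x<l) = >⇒𝟙≡0 x<l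

∑< : ℕ → (ℕ → ℕ) → ℕ
∑< zero    f = 0
∑< (suc n) f = ∑< n f + f n

infix 5 ∑<
syntax ∑< n (λ x → e) = ∑[ x < n ] e

∑<-cong : ∀ n {f g : ℕ → ℕ} → (∀ x → x < n → f x ≡ g x) → ∑< n f ≡ ∑< n g
∑<-cong zero    f≡g = refl
∑<-cong (suc n) f≡g = cong₂ _+_ (∑<-cong n (λ x x<n → f≡g x (m<n⇒m<1+n x<n))) (f≡g n ≤-refl)

∑<-zero : ∀ n → ∑[ x < n ] 0 ≡ 0
∑<-zero zero    = refl
∑<-zero (suc n) = cong (_+ 0) (∑<-zero n)

∑<-distrib-+ : ∀ n (f g : ℕ → ℕ) → ∑[ x < n ] f x + g x ≡ ∑< n f + ∑< n g
∑<-distrib-+ zero    f g = refl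
∑<-distrib-+ (suc n) f g = begin
  (∑[ x < n ] f x + g x) + (f n + g n) ≡⟨ cong (_+ (f n + g n)) (∑<-distrib-+ n f g) ⟩
  ∑< n f + ∑< n g + (f n + g n)        ≡⟨ +-+-commute (∑< n f) (∑< n g) (f n) (g n) ⟩
  ∑< n f + f n + (∑< n g + g n)        ∎
  where
  +-+-commute : ∀ a b c d → a + b + (c + d) ≡ a + c + (b + d)
  +-+-commute = solve-∀

∑<-distribˡ-* : ∀ n c (f : ℕ → ℕ) → ∑[ x < n ] c * f x ≡ c * ∑< n f
∑<-distribˡ-* zero    c f = sym (*-zeroʳ c)
∑<-distribˡ-* (suc n) c f = begin
  (∑[ x < n ] c * f x) + c * f n ≡⟨ cong (_+ c * f n) (∑<-distribˡ-* n c f) ⟩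
  c * ∑< n f + c * f n           ≡⟨ *-distribˡ-+ c (∑< n f) (f n) ⟨
  c * (∑< n f + f n)             ∎

sum-map-upTo : ∀ n (f : ℕ → ℕ) → sum (map f (upTo n)) ≡ ∑< n f
sum-map-upTo zero    f = refl
sum-map-upTo (suc n) f = begin
  sum (map f (upTo (suc n)))              ≡⟨ cong (λ xs → sum (map f xs)) (upTo-∷ʳ n) ⟨
  sum (map f (upTo n ++ n ∷ []))          ≡⟨ cong sum (map-++ f (upTo n) (n ∷ [])) ⟩
  sum (map f (upTo n) ++ f n ∷ [])        ≡⟨ sum-++ (map f (upTo n)) (f n ∷ []) ⟩
  sum (map f (upTo n)) + (f n + 0)        ≡⟨ cong₂ _+_ (sum-map-upTo n f) (+-identityʳ (f n)) ⟩
  ∑< n f + f n                            ∎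

gappedSum : ℕ → ℕ → ℕ → ℕ
gappedSum zero    lo n = 1
gappedSum (suc r) lo n = ∑[ x < n ] 𝟙[ lo ≤ x ] * x * gappedSum r (2 + x) n

gappedSum-empty : ∀ r {lo n} → n ≤ lo → gappedSum (suc r) lo n ≡ 0
gappedSum-empty r {lo} {n} n≤lo = begin
  ∑[ x < n ] 𝟙[ lo ≤ x ] * x * gappedSum r (2 + x) n
    ≡⟨ ∑<-cong n (λ x x<n → cong (λ i → i * x * gappedSum r (2 + x) n)
                                  (>⇒𝟙≡0 (<-≤-trans x<n n≤lo))) ⟩
  ∑[ x < n ] 0
    ≡⟨ ∑<-zero n ⟩
  0 ∎

gappedSum-guard : ∀ r lo n → 𝟙[ lo ≤ suc n ] * gappedSum (suc r) lo n ≡ gappedSum (suc r) lo n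
gappedSum-guard r lo n with lo ≤? suc n
... | yes lo≤1+n rewrite ≤⇒𝟙≡1 lo≤1+n = *-identityˡ _
... | no  lo≰1+n rewrite gappedSum-empty r (≤-trans (n≤1+n n) (<⇒≤ (≰⇒> lo≰1+n))) =
  *-zeroʳ 𝟙[ lo ≤ suc n ]

-- The tuples whose largest entry is n.
gappedSum-endingAt : ∀ r lo n →
  ∑[ x < 1 + n ] 𝟙[ lo ≤ x ] * x * (𝟙[ 2 + x ≤ 1 + n ] * (1 + n) * gappedSum r (2 + x) n)
    ≡ 𝟙[ lo ≤ 1 + n ] * (1 + n) * gappedSum (suc r) lo n
gappedSum-endingAt r lo n = begin
  ∑< n new + new n
    ≡⟨ cong (∑< n new +_) new-n≡0 ⟩
  ∑< n new + 0
    ≡⟨ +-identityʳ _ ⟩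
  ∑< n new
    ≡⟨ ∑<-cong n (λ x x<n → trans
         (cong (λ i → 𝟙[ lo ≤ x ] * x * (i * (1 + n) * gappedSum r (2 + x) n)) (≤⇒𝟙≡1 x<n))
         (pull-out 𝟙[ lo ≤ x ] x (1 + n) (gappedSum r (2 + x) n))) ⟩
  ∑[ x < n ] (1 + n) * (𝟙[ lo ≤ x ] * x * gappedSum r (2 + x) n)
    ≡⟨ ∑<-distribˡ-* n (1 + n) (λ x → 𝟙[ lo ≤ x ] * x * gappedSum r (2 + x) n) ⟩
  (1 + n) * gappedSum (suc r) lo n
    ≡⟨ cong ((1 + n) *_) (gappedSum-guard r lo n) ⟨
  (1 + n) * (𝟙[ lo ≤ 1 + n ] * gappedSum (suc r) lo n)
    ≡⟨ *-comm-assoc (1 + n) 𝟙[ lo ≤ 1 + n ] (gappedSum (suc r) lo n) ⟩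
  𝟙[ lo ≤ 1 + n ] * (1 + n) * gappedSum (suc r) lo n ∎
  where
  new : ℕ → ℕ
  new x = 𝟙[ lo ≤ x ] * x * (𝟙[ 2 + x ≤ 1 + n ] * (1 + n) * gappedSum r (2 + x) n)
  new-n≡0 : new n ≡ 0
  new-n≡0 rewrite >⇒𝟙≡0 (n<1+n n) = *-zeroʳ (𝟙[ lo ≤ n ] * n)
  pull-out : ∀ a x c g → a * x * (1 * c * g) ≡ c * (a * x * g)
  pull-out = solve-∀
  *-comm-assoc : ∀ c a g → c * (a * g) ≡ a * c * g
  *-comm-assoc = solve-∀

gappedSum-recurrence : ∀ r lo n →
  gappedSum (suc r) lo (2 + n) ≡ gappedSum (suc r) lo (1 + n) + 𝟙[ lo ≤ 1 + n ] * (1 + n) * gappedSum r lo n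
gappedSum-recurrence zero    lo n = refl
gappedSum-recurrence (suc r) lo n = begin
  ∑< (1 + n) (term (2 + n)) + term (2 + n) (1 + n)
    ≡⟨ cong (∑< (1 + n) (term (2 + n)) +_) top-term≡0 ⟩
  ∑< (1 + n) (term (2 + n)) + 0
    ≡⟨ +-identityʳ _ ⟩
  ∑< (1 + n) (term (2 + n))
    ≡⟨ ∑<-cong (1 + n) (λ x _ → term-split x) ⟩
  ∑[ x < 1 + n ] term (1 + n) x + new x
    ≡⟨ ∑<-distrib-+ (1 + n) (term (1 + n)) new ⟩
  gappedSum (2 + r) lo (1 + n) + ∑< (1 + n) new
    ≡⟨ cong (gappedSum (2 + r) lo (1 + n) +_) (gappedSum-endingAt r lo n) ⟩
  gappedSum (2 + r) lo (1 + n) + 𝟙[ lo ≤ 1 + n ] * (1 + n) * gappedSum (suc r) lo n ∎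
  where
  term : ℕ → ℕ → ℕ
  term m x = 𝟙[ lo ≤ x ] * x * gappedSum (suc r) (2 + x) m
  new : ℕ → ℕ
  new x = 𝟙[ lo ≤ x ] * x * (𝟙[ 2 + x ≤ 1 + n ] * (1 + n) * gappedSum r (2 + x) n)
  top-term≡0 : term (2 + n) (1 + n) ≡ 0
  top-term≡0 rewrite gappedSum-empty r {3 + n} {2 + n} (n≤1+n (2 + n)) =
    *-zeroʳ (𝟙[ lo ≤ 1 + n ] * (1 + n))
  term-split : ∀ x → term (2 + n) x ≡ term (1 + n) x + new x
  term-split x = trans (cong (𝟙[ lo ≤ x ] * x *_) (gappedSum-recurrence r (2 + x) n))
                       (*-distribˡ-+ (𝟙[ lo ≤ x ] * x) _ _)

_↓_ : ℕ → ℕ → ℕ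
n     ↓ zero  = 1
zero  ↓ suc k = 0
suc n ↓ suc k = suc n * (n ↓ k)

-- n ↓ (1 + k) = (n ∸ k) * (n ↓ k), with the subtraction moved to the other side.
↓-suc : ∀ n k → n ↓ suc k + k * (n ↓ k) ≡ n * (n ↓ k)
↓-suc zero    zero    = refl
↓-suc (suc n) zero    = +-identityʳ (suc n * 1)
↓-suc zero    (suc k) = *-zeroʳ (suc k)
↓-suc (suc n) (suc k) = begin
  suc n * (n ↓ suc k) + suc k * (suc n * (n ↓ k))  ≡⟨ regroup n k (n ↓ suc k) (n ↓ k) ⟩
  suc n * ((n ↓ suc k + k * (n ↓ k)) + n ↓ k)     ≡⟨ cong (λ t → suc n * (t + n ↓ k)) (↓-suc n k) ⟩
  suc n * (n * (n ↓ k) + n ↓ k)                   ≡⟨ cong (suc n *_) (+-comm (n * (n ↓ k)) (n ↓ k)) ⟩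
  suc n * (suc n * (n ↓ k))                       ∎
  where
  regroup : ∀ n k a b → suc n * a + suc k * (suc n * b) ≡ suc n * ((a + k * b) + b)
  regroup = solve-∀

↓-pascal : ∀ n k → suc n ↓ suc k ≡ n ↓ suc k + suc k * (n ↓ k)
↓-pascal n k = begin
  suc n * (n ↓ k)                   ≡⟨ +-comm (n ↓ k) (n * (n ↓ k)) ⟩
  n * (n ↓ k) + n ↓ k               ≡⟨ cong (_+ n ↓ k) (↓-suc n k) ⟨
  n ↓ suc k + k * (n ↓ k) + n ↓ k   ≡⟨ +-assoc (n ↓ suc k) (k * (n ↓ k)) (n ↓ k) ⟩
  n ↓ suc k + (k * (n ↓ k) + n ↓ k) ≡⟨ cong (n ↓ suc k +_) (+-comm (k * (n ↓ k)) (n ↓ k)) ⟩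
  n ↓ suc k + suc k * (n ↓ k)       ∎

↓-*-! : ∀ {n k} → k ≤ n → n ↓ k * (n ∸ k) ! ≡ n !
↓-*-! {n}     z≤n       = *-identityˡ (n !)
↓-*-! {suc n} {suc k} (s≤s k≤n) =
  trans (*-assoc (suc n) (n ↓ k) ((n ∸ k) !)) (cong (suc n *_) (↓-*-! k≤n))

<⇒↓≡0 : ∀ {n k} → n < k → n ↓ k ≡ 0
<⇒↓≡0 {zero}  (s≤s _)   = refl
<⇒↓≡0 {suc n} (s≤s n<k) = trans (cong (suc n *_) (<⇒↓≡0 n<k)) (*-zeroʳ (suc n))

P≡↓ : ∀ n k → n P k ≡ n ↓ k
P≡↓ n k with k ≤? n
... | yes k≤n = begin
  n P k                        ≡⟨ nPk≡n!/[n∸k]! k≤n ⟩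
  n ! / (n ∸ k) !              ≡⟨ cong (_/ (n ∸ k) !) (↓-*-! k≤n) ⟨
  n ↓ k * (n ∸ k) ! / (n ∸ k) ! ≡⟨ m*n/n≡m (n ↓ k) ((n ∸ k) !) ⟩
  n ↓ k                        ∎
  where instance _ = (n ∸ k) !≢0
... | no k≰n = trans (k>n⇒nPk≡0 (≰⇒> k≰n)) (sym (<⇒↓≡0 (≰⇒> k≰n)))

gappedSum-closed : ∀ r n → 2 ^ r * r ! * gappedSum r 0 n ≡ n ↓ (2 * r)
gappedSum-closed zero    n             = refl
gappedSum-closed (suc r) zero          = *-zeroʳ (2 ^ suc r * suc r !)
gappedSum-closed (suc r) (suc zero)    =
  trans (*-zeroʳ (2 ^ suc r * suc r !)) (sym (<⇒↓≡0 (*-monoʳ-≤ 2 (s≤s (z≤n {r})))))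
gappedSum-closed (suc r) (suc (suc n)) = begin
  2 ^ suc r * suc r ! * gappedSum (suc r) 0 (2 + n)
    ≡⟨ cong (2 ^ suc r * suc r ! *_) (gappedSum-recurrence r 0 n) ⟩
  2 ^ suc r * suc r ! * (gappedSum (suc r) 0 (1 + n) + 1 * (1 + n) * gappedSum r 0 n)
    ≡⟨ regroup (2 ^ r) (r !) r n (gappedSum (suc r) 0 (1 + n)) (gappedSum r 0 n) ⟩
  2 ^ suc r * suc r ! * gappedSum (suc r) 0 (1 + n) + 2 * suc r * ((1 + n) * (2 ^ r * r ! * gappedSum r 0 n))
    ≡⟨ cong₂ (λ a b → a + 2 * suc r * ((1 + n) * b))
             (gappedSum-closed (suc r) (suc n)) (gappedSum-closed r n) ⟩
  (1 + n) ↓ (2 * suc r) + 2 * suc r * ((1 + n) ↓ (1 + 2 * r))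
    ≡⟨ cong (λ k → (1 + n) ↓ k + k * ((1 + n) ↓ (1 + 2 * r))) (*-suc 2 r) ⟩
  (1 + n) ↓ (2 + 2 * r) + (2 + 2 * r) * ((1 + n) ↓ (1 + 2 * r))
    ≡⟨ ↓-pascal (1 + n) (1 + 2 * r) ⟨
  (2 + n) ↓ (2 + 2 * r)
    ≡⟨ cong ((2 + n) ↓_) (*-suc 2 r) ⟨
  (2 + n) ↓ (2 * suc r) ∎
  where
  regroup : ∀ p f r n a b →
    2 * p * (suc r * f) * (a + 1 * (1 + n) * b) ≡ 2 * p * (suc r * f) * a + 2 * suc r * ((1 + n) * (p * f * b))
  regroup = solve-∀

sum-map-concatMap : ∀ {A B : Set} (f : B → ℕ) (g : A → List B) xs →
  sum (map f (concatMap g xs)) ≡ sum (map (λ x → sum (map f (g x))) xs)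
sum-map-concatMap f g []       = refl
sum-map-concatMap f g (x ∷ xs) = begin
  sum (map f (g x ++ concatMap g xs))               ≡⟨ cong sum (map-++ f (g x) (concatMap g xs)) ⟩
  sum (map f (g x) ++ map f (concatMap g xs))       ≡⟨ sum-++ (map f (g x)) (map f (concatMap g xs)) ⟩
  sum (map f (g x)) + sum (map f (concatMap g xs))  ≡⟨ cong (sum (map f (g x)) +_) (sum-map-concatMap f g xs) ⟩
  sum (map f (g x)) + sum (map (λ x → sum (map f (g x))) xs) ∎

sum-map-*ˡ : ∀ {A : Set} c (f : A → ℕ) xs → sum (map (λ x → c * f x) xs) ≡ c * sum (map f xs)
sum-map-*ˡ c f []       = sym (*-zeroʳ c)
sum-map-*ˡ c f (x ∷ xs) = trans (cong (c * f x +_) (sum-map-*ˡ c f xs)) (sym (*-distribˡ-+ c (f x) _))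

sum-map-filter : ∀ {A : Set} {P : A → Set} (P? : Decidable P) (f w : A → ℕ) →
  (∀ x → P x → w x ≡ f x) → (∀ x → ¬ P x → w x ≡ 0) →
  ∀ xs → sum (map f (filter P? xs)) ≡ sum (map w xs)
sum-map-filter P? f w w≡f w≡0 []       = refl
sum-map-filter P? f w w≡f w≡0 (x ∷ xs) with P? x
... | yes Px = cong₂ _+_ (sym (w≡f x Px)) (sum-map-filter P? f w w≡f w≡0 xs)
... | no ¬Px = trans (sum-map-filter P? f w w≡f w≡0 xs) (cong (_+ sum (map w xs)) (sym (w≡0 x ¬Px)))

infix 4 _≤Head_

_≤Head_ : ∀ {r} → ℕ → Vec ℕ r → Set
lo ≤Head []      = ⊤
lo ≤Head (x ∷ _) = lo ≤ x

0≤Head : ∀ {r} (v : Vec ℕ r) → 0 ≤Head v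
0≤Head []      = tt
0≤Head (_ ∷ _) = z≤n

Gaps-∷⁻ : ∀ {r} x (v : Vec ℕ r) → Gaps (x ∷ v) → Gaps v × 2 + x ≤Head v
Gaps-∷⁻ x []      _            = tt , tt
Gaps-∷⁻ x (y ∷ v) (x+2≤y , gv) = gv , subst (_≤ y) (+-comm x 2) x+2≤y

Gaps-∷⁺ : ∀ {r} x (v : Vec ℕ r) → Gaps v → 2 + x ≤Head v → Gaps (x ∷ v)
Gaps-∷⁺ x []      _  _       = tt
Gaps-∷⁺ x (y ∷ v) gv 2+x≤y = subst (_≤ y) (+-comm 2 x) 2+x≤y , gv

gappedProd : ∀ {r} → ℕ → ℕ → Vec ℕ r → ℕ
gappedProd lo n []      = 1
gappedProd lo n (x ∷ v) = 𝟙[ lo ≤ x ] * 𝟙[ suc x ≤ n ] * x * gappedProd (2 + x) n v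

gappedProd-InJ : ∀ {r} lo m (v : Vec ℕ r) → InJ m v → lo ≤Head v → gappedProd lo (suc m) v ≡ prodVec v
gappedProd-InJ lo m []      _                                _    = refl
gappedProd-InJ lo m (x ∷ v) (((_ , x≤m) , bv) , gxv) lo≤x
  rewrite ≤⇒𝟙≡1 lo≤x | ≤⇒𝟙≡1 x≤m | +-identityʳ x =
  let gv , 2+x≤v = Gaps-∷⁻ x v gxv in cong (x *_) (gappedProd-InJ (2 + x) m v (bv , gv) 2+x≤v)

gappedProd-∉ : ∀ {r} lo m (v : Vec ℕ r) → ¬ (InJ m v × lo ≤Head v) → gappedProd lo (suc m) v ≡ 0
gappedProd-∉ lo m []      ∉ = ⊥-elim (∉ ((tt , tt) , tt))
gappedProd-∉ lo m (x ∷ v) ∉ with lo ≤? x | x ≤? m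
... | no lo≰x  | _      rewrite >⇒𝟙≡0 (≰⇒> lo≰x)                   = refl
... | yes lo≤x | no x≰m rewrite ≤⇒𝟙≡1 lo≤x | >⇒𝟙≡0 (s≤s (≰⇒> x≰m)) = refl
... | yes lo≤x | yes x≤m rewrite ≤⇒𝟙≡1 lo≤x | ≤⇒𝟙≡1 x≤m with x
...   | zero  = refl
...   | suc y = trans (cong ((suc y + 0) *_) (gappedProd-∉ (2 + suc y) m v ∉tail)) (*-zeroʳ (suc y + 0))
  where
  ∉tail : ¬ (InJ m v × 2 + suc y ≤Head v)
  ∉tail ((bv , gv) , 2+x≤v) = ∉ ((((s≤s z≤n , x≤m) , bv) , Gaps-∷⁺ (suc y) v gv 2+x≤v) , lo≤x)

sum-gappedProd : ∀ r lo m → sum (map (gappedProd lo (suc m)) (allVecs r m)) ≡ gappedSum r lo (suc m)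
sum-gappedProd zero    lo m = refl
sum-gappedProd (suc r) lo m = begin
  sum (map (gappedProd lo (suc m)) (concatMap (λ x → map (x ∷_) (allVecs r m)) (upTo (suc m))))
    ≡⟨ sum-map-concatMap (gappedProd lo (suc m)) (λ x → map (x ∷_) (allVecs r m)) (upTo (suc m)) ⟩
  sum (map (λ x → sum (map (gappedProd lo (suc m)) (map (x ∷_) (allVecs r m)))) (upTo (suc m)))
    ≡⟨ cong sum (map-cong first-entry (upTo (suc m))) ⟩
  sum (map (λ x → 𝟙[ lo ≤ x ] * 𝟙[ suc x ≤ suc m ] * x * gappedSum r (2 + x) (suc m)) (upTo (suc m)))
    ≡⟨ sum-map-upTo (suc m) _ ⟩
  ∑[ x < suc m ] 𝟙[ lo ≤ x ] * 𝟙[ suc x ≤ suc m ] * x * gappedSum r (2 + x) (suc m)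
    ≡⟨ ∑<-cong (suc m) (λ x x<1+m → cong (λ i → i * x * gappedSum r (2 + x) (suc m))
         (trans (cong (𝟙[ lo ≤ x ] *_) (≤⇒𝟙≡1 x<1+m)) (*-identityʳ 𝟙[ lo ≤ x ]))) ⟩
  gappedSum (suc r) lo (suc m) ∎
  where
  first-entry : ∀ x → sum (map (gappedProd lo (suc m)) (map (x ∷_) (allVecs r m)))
                    ≡ 𝟙[ lo ≤ x ] * 𝟙[ suc x ≤ suc m ] * x * gappedSum r (2 + x) (suc m)
  first-entry x = begin
    sum (map (gappedProd lo (suc m)) (map (x ∷_) (allVecs r m)))
      ≡⟨ cong sum (map-∘ (allVecs r m)) ⟨
    sum (map (λ v → 𝟙[ lo ≤ x ] * 𝟙[ suc x ≤ suc m ] * x * gappedProd (2 + x) (suc m) v) (allVecs r m))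
      ≡⟨ sum-map-*ˡ (𝟙[ lo ≤ x ] * 𝟙[ suc x ≤ suc m ] * x) (gappedProd (2 + x) (suc m)) (allVecs r m) ⟩
    𝟙[ lo ≤ x ] * 𝟙[ suc x ≤ suc m ] * x * sum (map (gappedProd (2 + x) (suc m)) (allVecs r m))
      ≡⟨ cong (𝟙[ lo ≤ x ] * 𝟙[ suc x ≤ suc m ] * x *_) (sum-gappedProd r (2 + x) m) ⟩
    𝟙[ lo ≤ x ] * 𝟙[ suc x ≤ suc m ] * x * gappedSum r (2 + x) (suc m) ∎

lemma4p2 : (r m : ℕ) → 1 ≤ r → 1 ≤ m →
    2 ^ r * r ! * sumJ r m ≡ (m + 1) P (2 * r)
lemma4p2 r m _ _ = begin
  2 ^ r * r ! * sumJ r m              ≡⟨ cong (2 ^ r * r ! *_) sumJ≡gappedSum ⟩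
  2 ^ r * r ! * gappedSum r 0 (suc m) ≡⟨ gappedSum-closed r (suc m) ⟩
  suc m ↓ (2 * r)                     ≡⟨ cong (_↓ (2 * r)) (+-comm 1 m) ⟩
  (m + 1) ↓ (2 * r)                   ≡⟨ P≡↓ (m + 1) (2 * r) ⟨
  (m + 1) P (2 * r)                   ∎
  where
  sumJ≡gappedSum : sumJ r m ≡ gappedSum r 0 (suc m)
  sumJ≡gappedSum = trans
    (sum-map-filter (inJ? m) prodVec (gappedProd 0 (suc m))
      (λ v v∈J → gappedProd-InJ 0 m v v∈J (0≤Head v))
      (λ v v∉J → gappedProd-∉ 0 m v (v∉J ∘ proj₁))
      (allVecs r m))
    (sum-gappedProd r 0 m)
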